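{- Let $G$ be a reduced graph which is not a complete graph. Then $$\rho(G)\leqslant\tau(G)=\min\big\{|\Delta(u,v)| : u,v \text{ distinct non-adjacent vertices of } G\big\}.$$
   Context: All graphs are finite and simple. The rank of a graph is the rank over $\mathbb{R}$ of its adjacency matrix. A graph is reduced if it has no isolated vertices and no two distinct vertices with the same set of neighbors; two distinct vertices with the same neighborhood are called duplicated vertices. For a vertex $v$, $N(v)$ is its set of neighbors, and $\Delta(u,v)$ denotes the symmetric difference of $N(u)$ and $N(v)$. For a graph $G$ with at least one edge, $\rho(G)$ is the minimum number of vertices whose removal results in a graph of smaller rank. For a non-complete graph $G$, $\tau(G)$ is the minimum number of vertices whose removal results in a graph having duplicated vertices. -}

module Defs where

open import Data.Nat using (ℕ; zero; suc; _≤_; _<_)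
open import Data.Bool using (Bool; true; false; if_then_else_; _xor_)
open import Data.Fin using (Fin; zero; suc)
open import Data.Fin.Subset using (Subset; _∈_; _∉_; ∣_∣; ⊤; ∁)
open import Data.Vec using (tabulate)
open import Data.Rational using (ℚ; 0ℚ; 1ℚ; _+_; _*_)
open import Data.Product using (Σ; ∃; _×_; _,_)
open import Function.Definitions using (Injective)
open import Relation.Binary.PropositionalEquality using (_≡_; _≢_)
open import Relation.Nullary using (¬_)

record Graph (n : ℕ) : Set where
  field
    adj    : Fin n → Fin n → Bool
    sym    : ∀ u v → adj u v ≡ adj v u
    irrefl : ∀ v → adj v v ≡ false
open Graph public

entry : Bool → ℚ
entry b = if b then 1ℚ else 0ℚ

Σℚ : (k : ℕ) → (Fin k → ℚ) → ℚ
Σℚ zero    f = 0ℚ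
Σℚ (suc k) f = f zero + Σℚ k (λ i → f (suc i))

module _ {n : ℕ} (G : Graph n) where

  -- The principal submatrix of the adjacency matrix on the vertex set T
  -- (i.e. the adjacency matrix of the induced subgraph G[T]) has k rows
  -- that are linearly independent over ℚ.
  IndepRows : Subset n → ℕ → Set
  IndepRows T k =
    Σ (Fin k → Fin n) λ f →
      Injective _≡_ _≡_ f × (∀ i → f i ∈ T) ×
      ((c : Fin k → ℚ) →
         (∀ j → j ∈ T → Σℚ k (λ i → c i * entry (adj G (f i) j)) ≡ 0ℚ) →
         ∀ i → c i ≡ 0ℚ)

  -- rank (G - S) < rank G, where rank = maximal number of independent rows
  RankDrops : Subset n → Set
  RankDrops S = ∃ λ k → IndepRows ⊤ k × ¬ IndepRows (∁ S) k

  HasDup : Subset n → Set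
  HasDup S = Σ (Fin n) λ u → Σ (Fin n) λ v →
    u ≢ v × u ∉ S × v ∉ S × (∀ w → w ∉ S → adj G u w ≡ adj G v w)

  Δ : Fin n → Fin n → Subset n
  Δ u v = tabulate (λ w → adj G u w xor adj G v w)

  Reduced : Set
  Reduced = (∀ v → ∃ λ w → adj G v w ≡ true)
          × (∀ u v → u ≢ v → ¬ (∀ w → adj G u w ≡ adj G v w))

  Complete : Set
  Complete = ∀ u v → u ≢ v → adj G u v ≡ true

  IsTau : ℕ → Set
  IsTau t = (∃ λ S → HasDup S × ∣ S ∣ ≡ t) × (∀ S → HasDup S → t ≤ ∣ S ∣)

  IsMinΔ : ℕ → Set
  IsMinΔ d = (Σ (Fin n) λ u → Σ (Fin n) λ v →
                 u ≢ v × adj G u v ≡ false × ∣ Δ u v ∣ ≡ d)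
           × (∀ u v → u ≢ v → adj G u v ≡ false → d ≤ ∣ Δ u v ∣)

-- Choose a non-adjacent pair u, v with |Δ(u,v)| minimal. Deleting S = Δ(u,v) makes u and v
-- duplicates; conversely, if u', v' become duplicates once S' is deleted, then u', v' are
-- non-adjacent and Δ(u',v') ⊆ S'. Hence τ(G) is that minimum.
-- For the rank, let T be the complement of S and pick, by Gaussian elimination over ℚ, a maximal
-- independent family of rows of the adjacency matrix restricted to the columns in T, of size r.
-- It spans all restricted rows, so G − S has rank at most r, while the corresponding full rows
-- are independent. They cannot span both the rows of u and of v: these agree on T, so their
-- coefficients would coincide and u, v would be duplicates in G. So G has r + 1 independent rows.

module Submission where

open import Defs hiding (sym)
open import Data.Nat using (ℕ; zero; suc; _≤_; _<_; z≤n; s≤s)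
import Data.Nat.Properties as ℕ
open import Data.Fin as Fin using (Fin; zero; suc; punchIn; punchOut)
open import Data.Fin.Properties using (all?; ¬∀⟶∃¬; punchIn-punchOut)
open import Data.Fin.Subset using (Subset; _∈_; _∉_; ∣_∣; ⊤; ∁; _⊆_)
open import Data.Fin.Subset.Properties using (_∈?_; ∈⊤; x∈∁p⇒x∉p; p⊆q⇒∣p∣≤∣q∣)
open import Data.Bool as Bool using (true; false; _xor_)
open import Data.Bool.Properties using (xor-same; ¬-not; not-distribˡ-xor)
open import Data.Vec.Properties using (lookup∘tabulate; []=⇒lookup; lookup⇒[]=)
open import Data.Vec.Functional using (Vector; insertAt; removeAt) renaming (_∷_ to _◂_)
open import Data.Vec.Functional.Properties using (insertAt-lookup; insertAt-punchIn)
open import Data.List using (List; []; _∷_; allFin; filter; cartesianProduct)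
open import Data.List.Membership.Propositional using () renaming (_∈_ to _∈ˡ_)
open import Data.List.Membership.Propositional.Properties using (∈-allFin; ∈-cartesianProduct⁺; ∈-filter⁺)
open import Data.List.Relation.Unary.Any using (here; there)
import Data.List.Relation.Unary.All as All
open import Data.List.Relation.Unary.All.Properties using (all-filter)
open import Data.List.Extrema.Nat using (argmin; argmin-all; f[argmin]≤f[⊤]; f[argmin]≤f[xs])
open import Data.Rational as ℚ using (ℚ; 0ℚ; 1ℚ; _+_; _*_; -_; _-_; 1/_)
import Data.Rational.Properties as ℚ
open import Data.Rational.Solver using (module +-*-Solver)
open +-*-Solver using (solve; _:+_; _:*_; _:-_; :-_; _:=_; con)
open import Algebra.Bundles using (Ring)
open import Algebra.Properties.Semiring.Sum (Ring.semiring ℚ.+-*-ring)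
  using (sum; sum-syntax; sum-cong-≗; sum-replicate-zero; sum-remove; ∑-distrib-+; ∑-comm; *-distribˡ-sum; *-distribʳ-sum)
open import Data.Product as Product using (∃; ∃-syntax; _×_; _,_; proj₁; proj₂)
open import Data.Sum as Sum using (_⊎_; inj₁; inj₂; [_,_]′)
open import Relation.Unary using (Pred; Decidable)
open import Relation.Nullary using (¬_; Dec; yes; no; ¬?; _×-dec_; contradiction)
open import Relation.Nullary.Decidable using (decidable-stable)
open import Algebra.Properties.Group ℚ.+-0-group using () renaming (x∙y⁻¹≈ε⇒x≈y to x-y≡0⇒x≡y)
open import Relation.Binary.PropositionalEquality using (_≡_; _≢_; refl; sym; trans; cong; cong₂; subst; module ≡-Reasoning)

Σℚ≡sum : ∀ k (f : Fin k → ℚ) → Σℚ k f ≡ sum f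
Σℚ≡sum zero    f = refl
Σℚ≡sum (suc k) f = cong (f zero +_) (Σℚ≡sum k (λ i → f (suc i)))

sum-zero : ∀ {m} {f : Fin m → ℚ} → (∀ i → f i ≡ 0ℚ) → sum f ≡ 0ℚ
sum-zero {m} f≡0 = trans (sum-cong-≗ f≡0) (sum-replicate-zero m)

*-cancelʳ-≡0 : ∀ {x y} → y ≢ 0ℚ → x * y ≡ 0ℚ → x ≡ 0ℚ
*-cancelʳ-≡0 {x} {y} y≢0 xy≡0 = begin
  x                ≡⟨ sym (ℚ.*-identityʳ x) ⟩
  x * 1ℚ           ≡⟨ cong (x *_) (sym (ℚ.*-inverseʳ y)) ⟩
  x * (y * (1/ y)) ≡⟨ sym (ℚ.*-assoc x y (1/ y)) ⟩
  (x * y) * (1/ y) ≡⟨ cong (_* (1/ y)) xy≡0 ⟩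
  0ℚ * (1/ y)      ≡⟨ ℚ.*-zeroˡ (1/ y) ⟩
  0ℚ               ∎
  where open ≡-Reasoning
        instance _ = ℚ.≢-nonZero y≢0

Family : ℕ → ℕ → Set
Family m k = Fin m → Vector ℚ k

lincomb : ∀ {m k} → Vector ℚ m → Family m k → Vector ℚ k
lincomb {m} c V j = ∑[ i < m ] (c i * V i j)

Independent : ∀ {m k} → Family m k → Set
Independent V = ∀ c → (∀ j → lincomb c V j ≡ 0ℚ) → ∀ i → c i ≡ 0ℚ

Dependent : ∀ {m k} → Family m k → Set
Dependent V = ∃[ c ] (∃[ i ] c i ≢ 0ℚ) × (∀ j → lincomb c V j ≡ 0ℚ)

_∈Span_ : ∀ {r k} → Vector ℚ k → Family r k → Set
x ∈Span B = ∃[ c ] ∀ j → x j ≡ lincomb c B j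

Dependent⇒¬Independent : ∀ {m k} {V : Family m k} → Dependent V → ¬ Independent V
Dependent⇒¬Independent (c , (i , cᵢ≢0) , rel) ind = cᵢ≢0 (ind c rel i)

lincomb-zeroˡ : ∀ {m k} {c : Vector ℚ m} (V : Family m k) j → (∀ i → c i ≡ 0ℚ) → lincomb c V j ≡ 0ℚ
lincomb-zeroˡ V j c≡0 = sum-zero (λ i → trans (cong (_* V i j) (c≡0 i)) (ℚ.*-zeroˡ (V i j)))

lincomb-zeroʳ : ∀ {m k} (c : Vector ℚ m) (V : Family m k) j → (∀ i → V i j ≡ 0ℚ) → lincomb c V j ≡ 0ℚ
lincomb-zeroʳ c V j V≡0 = sum-zero (λ i → trans (cong (c i *_) (V≡0 i)) (ℚ.*-zeroʳ (c i)))

lincomb-scale : ∀ {m k} a (c : Vector ℚ m) (V : Family m k) j →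
  lincomb (λ i → a * c i) V j ≡ a * lincomb c V j
lincomb-scale a c V j = trans (sum-cong-≗ (λ i → ℚ.*-assoc a (c i) (V i j))) (sym (*-distribˡ-sum a (λ i → c i * V i j)))

lincomb-− : ∀ {m k} (c d : Vector ℚ m) (V : Family m k) j →
  lincomb (λ i → c i - d i) V j ≡ lincomb c V j - lincomb d V j
lincomb-− {m} c d V j = begin
  ∑[ i < m ] ((c i - d i) * V i j)
    ≡⟨ sum-cong-≗ (λ i → solve 3 (λ a b v → (a :- b) :* v := a :* v :+ con (- 1ℚ) :* (b :* v)) refl (c i) (d i) (V i j)) ⟩
  ∑[ i < m ] (c i * V i j + - 1ℚ * (d i * V i j))
    ≡⟨ ∑-distrib-+ (λ i → c i * V i j) (λ i → - 1ℚ * (d i * V i j)) ⟩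
  lincomb c V j + ∑[ i < m ] (- 1ℚ * (d i * V i j))
    ≡⟨ cong (lincomb c V j +_) (sym (*-distribˡ-sum (- 1ℚ) (λ i → d i * V i j))) ⟩
  lincomb c V j + - 1ℚ * lincomb d V j
    ≡⟨ solve 2 (λ x y → x :+ con (- 1ℚ) :* y := x :- y) refl (lincomb c V j) (lincomb d V j) ⟩
  lincomb c V j - lincomb d V j ∎
  where open ≡-Reasoning

lincomb-assoc : ∀ {m r k} (c : Vector ℚ m) (M : Family m r) (B : Family r k) j →
  lincomb c (λ i → lincomb (M i) B) j ≡ lincomb (lincomb c M) B j
lincomb-assoc {m} {r} c M B j = begin
  ∑[ i < m ] (c i * ∑[ l < r ] (M i l * B l j))
    ≡⟨ sum-cong-≗ (λ i → *-distribˡ-sum (c i) (λ l → M i l * B l j)) ⟩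
  ∑[ i < m ] ∑[ l < r ] (c i * (M i l * B l j))
    ≡⟨ ∑-comm (λ i l → c i * (M i l * B l j)) ⟩
  ∑[ l < r ] ∑[ i < m ] (c i * (M i l * B l j))
    ≡⟨ sum-cong-≗ (λ l → sum-cong-≗ (λ i → sym (ℚ.*-assoc (c i) (M i l) (B l j)))) ⟩
  ∑[ l < r ] ∑[ i < m ] (c i * M i l * B l j)
    ≡⟨ sum-cong-≗ (λ l → sym (*-distribʳ-sum (B l j) (λ i → c i * M i l))) ⟩
  ∑[ l < r ] (lincomb c M l * B l j) ∎
  where open ≡-Reasoning

unit : ∀ {m} → Fin (suc m) → Vector ℚ (suc m)
unit i = insertAt (λ _ → 0ℚ) i 1ℚ

unit-≢ : ∀ {m} {i j : Fin (suc m)} → i ≢ j → unit i j ≡ 0ℚ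
unit-≢ {i = i} i≢j = subst (λ j → unit i j ≡ 0ℚ) (punchIn-punchOut i≢j) (insertAt-punchIn _ i 1ℚ (punchOut i≢j))

lincomb-unit : ∀ {m k} (i : Fin (suc m)) (V : Family (suc m) k) j → lincomb (unit i) V j ≡ V i j
lincomb-unit {m} i V j = begin
  lincomb (unit i) V j
    ≡⟨ sum-remove {i = i} (λ l → unit i l * V l j) ⟩
  unit i i * V i j + ∑[ l < m ] (unit i (punchIn i l) * V (punchIn i l) j)
    ≡⟨ cong₂ _+_ (cong (_* V i j) (insertAt-lookup _ i 1ℚ)) (lincomb-zeroˡ (λ l → V (punchIn i l)) j (insertAt-punchIn _ i 1ℚ)) ⟩
  1ℚ * V i j + 0ℚ
    ≡⟨ solve 1 (λ v → con 1ℚ :* v :+ con 0ℚ := v) refl (V i j) ⟩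
  V i j ∎
  where open ≡-Reasoning

Independent⇒Injective : ∀ {m k} {V : Family m k} → Independent V →
  ∀ {i i'} → (∀ j → V i j ≡ V i' j) → i ≡ i'
Independent⇒Injective {suc m} {V = V} ind {i} {i'} Vi≗Vi' with i Fin.≟ i'
... | yes i≡i' = i≡i'
... | no i≢i' = contradiction (ind c rel i) cᵢ≢0
  where
  c = λ l → unit i l - unit i' l
  rel : ∀ j → lincomb c V j ≡ 0ℚ
  rel j = begin
    lincomb c V j
      ≡⟨ lincomb-− (unit i) (unit i') V j ⟩
    lincomb (unit i) V j - lincomb (unit i') V j
      ≡⟨ cong₂ _-_ (trans (lincomb-unit i V j) (Vi≗Vi' j)) (lincomb-unit i' V j) ⟩
    V i' j - V i' j
      ≡⟨ ℚ.+-inverseʳ (V i' j) ⟩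
    0ℚ ∎
    where open ≡-Reasoning
  cᵢ≢0 : c i ≢ 0ℚ
  cᵢ≢0 cᵢ≡0 with () ← trans (sym (cong₂ _-_ (insertAt-lookup _ i 1ℚ) (unit-≢ (λ e → i≢i' (sym e))))) cᵢ≡0

module Pivot {m k} (V : Family (suc m) (suc k)) (p : Fin (suc m)) (piv≢0 : V p zero ≢ 0ℚ) where
  private
    instance piv-nonZero = ℚ.≢-nonZero piv≢0

    piv : ℚ
    piv = V p zero

    others : Family m (suc k)
    others i = V (punchIn p i)

    ratio : Vector ℚ m
    ratio i = others i zero * 1/ piv

    ratio-piv : ∀ i → ratio i * piv ≡ others i zero
    ratio-piv i = begin
      others i zero * 1/ piv * piv   ≡⟨ ℚ.*-assoc (others i zero) (1/ piv) piv ⟩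
      others i zero * (1/ piv * piv) ≡⟨ cong (others i zero *_) (ℚ.*-inverseˡ piv) ⟩
      others i zero * 1ℚ             ≡⟨ ℚ.*-identityʳ (others i zero) ⟩
      others i zero                  ∎
      where open ≡-Reasoning

  reduced : Family m k
  reduced i j = others i (suc j) - ratio i * V p (suc j)

  private
    share : Vector ℚ m → ℚ
    share c' = ∑[ i < m ] (c' i * ratio i)

    -- the coefficient of the pivot row when a combination of V is rewritten over the pivot row and reduced
    weight : Vector ℚ (suc m) → ℚ
    weight c = c p + share (removeAt c p)

    lincomb-column₀ : ∀ c → lincomb c V zero ≡ weight c * piv
    lincomb-column₀ c = begin
      lincomb c V zero
        ≡⟨ sum-remove {i = p} (λ l → c l * V l zero) ⟩
      c p * piv + ∑[ i < m ] (c' i * others i zero)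
        ≡⟨ cong (c p * piv +_) (sum-cong-≗ (λ i → cong (c' i *_) (sym (ratio-piv i)))) ⟩
      c p * piv + ∑[ i < m ] (c' i * (ratio i * piv))
        ≡⟨ cong (c p * piv +_) (sum-cong-≗ (λ i → sym (ℚ.*-assoc (c' i) (ratio i) piv))) ⟩
      c p * piv + ∑[ i < m ] (c' i * ratio i * piv)
        ≡⟨ cong (c p * piv +_) (sym (*-distribʳ-sum piv (λ i → c' i * ratio i))) ⟩
      c p * piv + share c' * piv
        ≡⟨ sym (ℚ.*-distribʳ-+ piv (c p) (share c')) ⟩
      weight c * piv ∎
      where open ≡-Reasoning
            c' = removeAt c p

    lincomb-reduced : ∀ c' j → lincomb c' reduced j ≡ lincomb c' others (suc j) + - V p (suc j) * share c'
    lincomb-reduced c' j = begin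
      ∑[ i < m ] (c' i * (others i (suc j) - ratio i * y))
        ≡⟨ sum-cong-≗ (λ i → solve 4 (λ c o r y → c :* (o :- r :* y) := c :* o :+ (:- y) :* (c :* r)) refl (c' i) (others i (suc j)) (ratio i) y) ⟩
      ∑[ i < m ] (c' i * others i (suc j) + - y * (c' i * ratio i))
        ≡⟨ ∑-distrib-+ (λ i → c' i * others i (suc j)) (λ i → - y * (c' i * ratio i)) ⟩
      lincomb c' others (suc j) + ∑[ i < m ] (- y * (c' i * ratio i))
        ≡⟨ cong (lincomb c' others (suc j) +_) (sym (*-distribˡ-sum (- y) (λ i → c' i * ratio i))) ⟩
      lincomb c' others (suc j) + - y * share c' ∎
      where open ≡-Reasoning
            y = V p (suc j)

    lincomb-column-suc : ∀ c j → lincomb c V (suc j) ≡ lincomb (removeAt c p) reduced j + weight c * V p (suc j)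
    lincomb-column-suc c j = begin
      lincomb c V (suc j)
        ≡⟨ sum-remove {i = p} (λ l → c l * V l (suc j)) ⟩
      c p * y + L
        ≡⟨ solve 4 (λ cp L y s → cp :* y :+ L := (L :+ (:- y) :* s) :+ (cp :+ s) :* y) refl (c p) L y (share c') ⟩
      (L + - y * share c') + weight c * y
        ≡⟨ cong (_+ weight c * y) (sym (lincomb-reduced c' j)) ⟩
      lincomb c' reduced j + weight c * y ∎
      where open ≡-Reasoning
            c' = removeAt c p
            y = V p (suc j)
            L = lincomb c' others (suc j)

  dependent : Dependent reduced → Dependent V
  dependent (c' , (i , c'ᵢ≢0) , rel) = c , (punchIn p i , λ cᵢ≡0 → c'ᵢ≢0 (trans (sym (insertAt-punchIn c' p _ i)) cᵢ≡0)) , rel′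
    where
    c = insertAt c' p (- share c')
    removeAt-c : ∀ i → removeAt c p i ≡ c' i
    removeAt-c = insertAt-punchIn c' p (- share c')
    weight≡0 : weight c ≡ 0ℚ
    weight≡0 = begin
      c p + share (removeAt c p)
        ≡⟨ cong₂ _+_ (insertAt-lookup c' p _) (sum-cong-≗ (λ i → cong (_* ratio i) (removeAt-c i))) ⟩
      - share c' + share c'
        ≡⟨ ℚ.+-inverseˡ (share c') ⟩
      0ℚ ∎
      where open ≡-Reasoning
    rel′ : ∀ j → lincomb c V j ≡ 0ℚ
    rel′ zero    = trans (lincomb-column₀ c) (trans (cong (_* piv) weight≡0) (ℚ.*-zeroˡ piv))
    rel′ (suc j) = begin
      lincomb c V (suc j)
        ≡⟨ lincomb-column-suc c j ⟩
      lincomb (removeAt c p) reduced j + weight c * V p (suc j)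
        ≡⟨ cong₂ (λ a w → a + w * V p (suc j)) (trans (sum-cong-≗ (λ i → cong (_* reduced i j) (removeAt-c i))) (rel j)) weight≡0 ⟩
      0ℚ + 0ℚ * V p (suc j)
        ≡⟨ solve 1 (λ y → con 0ℚ :+ con 0ℚ :* y := con 0ℚ) refl (V p (suc j)) ⟩
      0ℚ ∎
      where open ≡-Reasoning

  independent : Independent reduced → Independent V
  independent ind c rel = c≡0
    where
    weight≡0 : weight c ≡ 0ℚ
    weight≡0 = *-cancelʳ-≡0 piv≢0 (trans (sym (lincomb-column₀ c)) (rel zero))
    c'≡0 : ∀ i → removeAt c p i ≡ 0ℚ
    c'≡0 = ind (removeAt c p) λ j → begin
      lincomb (removeAt c p) reduced j
        ≡⟨ solve 2 (λ a y → a := a :+ con 0ℚ :* y) refl _ (V p (suc j)) ⟩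
      lincomb (removeAt c p) reduced j + 0ℚ * V p (suc j)
        ≡⟨ cong (λ w → lincomb (removeAt c p) reduced j + w * V p (suc j)) (sym weight≡0) ⟩
      lincomb (removeAt c p) reduced j + weight c * V p (suc j)
        ≡⟨ sym (lincomb-column-suc c j) ⟩
      lincomb c V (suc j)
        ≡⟨ rel (suc j) ⟩
      0ℚ ∎
      where open ≡-Reasoning
    c-pivot≡0 : c p ≡ 0ℚ
    c-pivot≡0 = begin
      c p
        ≡⟨ sym (ℚ.+-identityʳ (c p)) ⟩
      c p + 0ℚ
        ≡⟨ cong (c p +_) (sym (sum-zero (λ i → trans (cong (_* ratio i) (c'≡0 i)) (ℚ.*-zeroˡ (ratio i))))) ⟩
      weight c
        ≡⟨ weight≡0 ⟩
      0ℚ ∎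
      where open ≡-Reasoning
    c≡0 : ∀ x → c x ≡ 0ℚ
    c≡0 x with p Fin.≟ x
    ... | yes refl = c-pivot≡0
    ... | no p≢x   = subst (λ x → c x ≡ 0ℚ) (punchIn-punchOut p≢x) (c'≡0 (punchOut p≢x))

Dependent⊎Independent×≤ : ∀ k m (V : Family m k) → Dependent V ⊎ (Independent V × m ≤ k)
Dependent⊎Independent×≤ k       zero    V = inj₂ ((λ _ _ ()) , z≤n)
Dependent⊎Independent×≤ zero    (suc m) V = inj₁ ((λ _ → 1ℚ) , (zero , λ ()) , λ ())
Dependent⊎Independent×≤ (suc k) (suc m) V with all? (λ i → V i zero ℚ.≟ 0ℚ)
... | yes column₀≡0 = Sum.map dependent independent (Dependent⊎Independent×≤ k (suc m) (λ i j → V i (suc j)))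
  where
  dependent : Dependent (λ i j → V i (suc j)) → Dependent V
  dependent (c , c≢0 , rel) = c , c≢0 , λ { zero → lincomb-zeroʳ c V zero column₀≡0 ; (suc j) → rel j }
  independent : Independent (λ i j → V i (suc j)) × suc m ≤ k → Independent V × suc m ≤ suc k
  independent (ind , m≤k) = (λ c rel → ind c (λ j → rel (suc j))) , ℕ.m≤n⇒m≤1+n m≤k
... | no ¬column₀≡0 with ¬∀⟶∃¬ _ _ (λ i → V i zero ℚ.≟ 0ℚ) ¬column₀≡0
... | p , piv≢0 = Sum.map dependent (Product.map independent s≤s) (Dependent⊎Independent×≤ k m reduced)
  where open Pivot V p piv≢0

Dependent⊎Independent : ∀ {m k} (V : Family m k) → Dependent V ⊎ Independent V
Dependent⊎Independent V = Sum.map₂ proj₁ (Dependent⊎Independent×≤ _ _ V)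

spanned-by-fewer⇒Dependent : ∀ {m r k} {V : Family m k} (B : Family r k) →
  (∀ i → V i ∈Span B) → r < m → Dependent V
spanned-by-fewer⇒Dependent {m} {r} {V = V} B spans r<m =
  [ dependent , (λ (_ , m≤r) → contradiction m≤r (ℕ.<⇒≱ r<m)) ]′ (Dependent⊎Independent×≤ r m M)
  where
  M : Family m r
  M i = proj₁ (spans i)
  dependent : Dependent M → Dependent V
  dependent (c , c≢0 , rel) = c , c≢0 , λ j → begin
    lincomb c V j                         ≡⟨ sum-cong-≗ (λ i → cong (c i *_) (proj₂ (spans i) j)) ⟩
    lincomb c (λ i → lincomb (M i) B) j   ≡⟨ lincomb-assoc c M B j ⟩
    lincomb (lincomb c M) B j             ≡⟨ lincomb-zeroˡ B j rel ⟩
    0ℚ                                    ∎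
    where open ≡-Reasoning

∈Span-∷ : ∀ {r k} {x : Vector ℚ k} (y : Vector ℚ k) {B : Family r k} → x ∈Span B → x ∈Span (y ◂ B)
∈Span-∷ y {B} (a , x≡a·B) = (0ℚ ◂ a) , λ j →
  trans (x≡a·B j) (sym (trans (cong (_+ lincomb a B j) (ℚ.*-zeroˡ (y j))) (ℚ.+-identityˡ (lincomb a B j))))

head-∈Span : ∀ {r k} (y : Vector ℚ k) (B : Family r k) → y ∈Span (y ◂ B)
head-∈Span y B = (1ℚ ◂ λ _ → 0ℚ) , λ j →
  sym (trans (cong₂ _+_ (ℚ.*-identityˡ (y j)) (lincomb-zeroˡ B j (λ _ → refl))) (ℚ.+-identityʳ (y j)))

Dependent-∷⇒∈Span : ∀ {r k} {x : Vector ℚ k} {B : Family r k} → Independent B → Dependent (x ◂ B) → x ∈Span B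
Dependent-∷⇒∈Span {x = x} {B} ind (c , (i , cᵢ≢0) , rel) with c zero ℚ.≟ 0ℚ
... | yes c₀≡0 = contradiction (c≡0 i) cᵢ≢0
  where
  c≡0 : ∀ i → c i ≡ 0ℚ
  c≡0 zero    = c₀≡0
  c≡0 (suc i) = ind (λ l → c (suc l)) tail-rel i
    where
    tail-rel : ∀ j → lincomb (λ l → c (suc l)) B j ≡ 0ℚ
    tail-rel j = begin
      lincomb (λ l → c (suc l)) B j             ≡⟨ sym (ℚ.+-identityˡ _) ⟩
      0ℚ + lincomb (λ l → c (suc l)) B j        ≡⟨ cong (_+ _) (sym (trans (cong (_* x j) c₀≡0) (ℚ.*-zeroˡ (x j)))) ⟩
      c zero * x j + lincomb (λ l → c (suc l)) B j ≡⟨ rel j ⟩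
      0ℚ                                        ∎
      where open ≡-Reasoning
... | no c₀≢0 = (λ l → - (1/ c zero) * c (suc l)) , λ j → sym (begin
  lincomb (λ l → - (1/ c₀) * c (suc l)) B j
    ≡⟨ lincomb-scale (- (1/ c₀)) (λ l → c (suc l)) B j ⟩
  - (1/ c₀) * L j
    ≡⟨ cong (- (1/ c₀) *_) (solve 2 (λ a l → l := (a :+ l) :- a) refl (c₀ * x j) (L j)) ⟩
  - (1/ c₀) * ((c₀ * x j + L j) - c₀ * x j)
    ≡⟨ cong (λ z → - (1/ c₀) * (z - c₀ * x j)) (rel j) ⟩
  - (1/ c₀) * (0ℚ - c₀ * x j)
    ≡⟨ solve 3 (λ y c x → (:- y) :* (con 0ℚ :- c :* x) := (y :* c) :* x) refl (1/ c₀) c₀ (x j) ⟩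
  (1/ c₀ * c₀) * x j
    ≡⟨ cong (_* x j) (ℚ.*-inverseˡ c₀) ⟩
  1ℚ * x j
    ≡⟨ ℚ.*-identityˡ (x j) ⟩
  x j ∎)
  where open ≡-Reasoning
        instance _ = ℚ.≢-nonZero c₀≢0
        c₀ = c zero
        L = lincomb (λ l → c (suc l)) B

record Basis {A : Set} {k} (V : A → Vector ℚ k) (xs : List A) : Set where
  field
    size        : ℕ
    index       : Fin size → A
    independent : Independent (λ i → V (index i))
    spans       : ∀ {x} → x ∈ˡ xs → V x ∈Span (λ i → V (index i))

basis : ∀ {A : Set} {k} (V : A → Vector ℚ k) (xs : List A) → Basis V xs
basis V []       = record { size = 0 ; index = λ () ; independent = λ _ _ () ; spans = λ () }
basis V (x ∷ xs) = extend (basis V xs)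
  where
  extend : Basis V xs → Basis V (x ∷ xs)
  extend B with Dependent⊎Independent (V x ◂ (λ i → V (Basis.index B i)))
  ... | inj₁ dep = record
    { size        = size
    ; index       = index
    ; independent = independent
    ; spans       = λ { (here refl) → Dependent-∷⇒∈Span independent dep ; (there x∈) → spans x∈ }
    }
    where open Basis B
  ... | inj₂ ind = record
    { size        = suc size
    ; index       = x ◂ index
    ; independent = ind
    ; spans       = λ { (here refl) → head-∈Span (V x) _ ; (there x∈) → ∈Span-∷ (V x) (spans x∈) }
    }
    where open Basis B

mask : ∀ {P : Set} → Dec P → ℚ → ℚ
mask (yes _) x = x
mask (no  _) _ = 0ℚ

mask-yes : ∀ {P : Set} (d : Dec P) {x} → P → mask d x ≡ x
mask-yes (yes _) _ = refl
mask-yes (no ¬p) p = contradiction p ¬p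

mask-zero : ∀ {P : Set} (d : Dec P) → mask d 0ℚ ≡ 0ℚ
mask-zero (yes _) = refl
mask-zero (no  _) = refl

mask-cong : ∀ {P : Set} (d : Dec P) {x y} → (P → x ≡ y) → mask d x ≡ mask d y
mask-cong (yes p) x≡y = x≡y p
mask-cong (no  _) _   = refl

mask-lincomb : ∀ {P : Set} (d : Dec P) {m} (c v : Vector ℚ m) →
  ∑[ i < m ] (c i * mask d (v i)) ≡ mask d (∑[ i < m ] (c i * v i))
mask-lincomb (yes _) c v = refl
mask-lincomb (no  _) c v = sum-zero (λ i → ℚ.*-zeroʳ (c i))

restrict : ∀ {n} → Subset n → Vector ℚ n → Vector ℚ n
restrict T x j = mask (j ∈? T) (x j)

lincomb-restrict : ∀ {m n} (T : Subset n) (c : Vector ℚ m) (V : Family m n) j →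
  lincomb c (λ i → restrict T (V i)) j ≡ restrict T (lincomb c V) j
lincomb-restrict T c V j = mask-lincomb (j ∈? T) c (λ i → V i j)

Independent-restrict⇒Independent : ∀ {m n} {T : Subset n} {V : Family m n} →
  Independent (λ i → restrict T (V i)) → Independent V
Independent-restrict⇒Independent {T = T} {V} ind c rel = ind c λ j →
  trans (lincomb-restrict T c V j) (trans (cong (mask (j ∈? T)) (rel j)) (mask-zero (j ∈? T)))

∈Span-determined-on : ∀ {r n} {T : Subset n} {B : Family r n} {x y : Vector ℚ n} →
  Independent (λ i → restrict T (B i)) → x ∈Span B → y ∈Span B →
  (∀ j → j ∈ T → x j ≡ y j) → ∀ j → x j ≡ y j
∈Span-determined-on {T = T} {B} {x} {y} ind (a , x≡a·B) (b , y≡b·B) x≗y j = begin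
  x j            ≡⟨ x≡a·B j ⟩
  lincomb a B j  ≡⟨ sum-cong-≗ (λ i → cong (_* B i j) (x-y≡0⇒x≡y (a i) (b i) (ind (λ i → a i - b i) rel i))) ⟩
  lincomb b B j  ≡⟨ sym (y≡b·B j) ⟩
  y j            ∎
  where
  open ≡-Reasoning
  rel : ∀ j → lincomb (λ i → a i - b i) (λ i → restrict T (B i)) j ≡ 0ℚ
  rel j = begin
    lincomb (λ i → a i - b i) (λ i → restrict T (B i)) j
      ≡⟨ lincomb-− a b (λ i → restrict T (B i)) j ⟩
    lincomb a (λ i → restrict T (B i)) j - lincomb b (λ i → restrict T (B i)) j
      ≡⟨ cong₂ _-_ (lincomb-restrict T a B j) (lincomb-restrict T b B j) ⟩
    restrict T (lincomb a B) j - restrict T (lincomb b B) j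
      ≡⟨ cong (_- restrict T (lincomb b B) j) (mask-cong (j ∈? T) λ j∈T → trans (sym (x≡a·B j)) (trans (x≗y j j∈T) (y≡b·B j))) ⟩
    restrict T (lincomb b B) j - restrict T (lincomb b B) j
      ≡⟨ ℚ.+-inverseʳ (restrict T (lincomb b B) j) ⟩
    0ℚ ∎

minimiser : ∀ {A : Set} {p} {P : Pred A p} → Decidable P → (f : A → ℕ) (xs : List A) →
  (∀ {x} → x ∈ˡ xs → ¬ P x) ⊎ ∃[ x ] P x × (∀ {y} → y ∈ˡ xs → P y → f x ≤ f y)
minimiser P? f xs with filter P? xs | all-filter P? xs | (λ {y} → ∈-filter⁺ P? {y} {xs})
... | []     | _             | ∈filter = inj₁ λ x∈ px → contradiction (∈filter x∈ px) λ ()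
... | z ∷ zs | pz All.∷ pzs  | ∈filter = inj₂ (argmin f z zs , argmin-all f pz pzs , λ y∈ py → least (∈filter y∈ py))
  where
  least : ∀ {y} → y ∈ˡ z ∷ zs → f (argmin f z zs) ≤ f y
  least (here refl) = f[argmin]≤f[⊤] {f = f} z zs
  least (there y∈)  = All.lookup (f[argmin]≤f[xs] {f = f} z zs) y∈

row : ∀ {n} → Graph n → Family n n
row G w j = entry (adj G w j)

entry-injective : ∀ {a b} → entry a ≡ entry b → a ≡ b
entry-injective {true}  {true}  _ = refl
entry-injective {false} {false} _ = refl
entry-injective {true}  {false} ()
entry-injective {false} {true}  ()

≢⇒xor≡true : ∀ {a b} → a ≢ b → a xor b ≡ true
≢⇒xor≡true {a} {b} a≢b =
  trans (cong (_xor b) (¬-not a≢b)) (trans (sym (not-distribˡ-xor b b)) (cong Bool.not (xor-same b)))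

module _ {n} (G : Graph n) where

  ∈Δ⇒xor : ∀ {u v w} → w ∈ Δ G u v → adj G u w xor adj G v w ≡ true
  ∈Δ⇒xor {u} {v} {w} w∈Δ = trans (sym (lookup∘tabulate (λ w → adj G u w xor adj G v w) w)) ([]=⇒lookup w∈Δ)

  xor⇒∈Δ : ∀ {u v w} → adj G u w xor adj G v w ≡ true → w ∈ Δ G u v
  xor⇒∈Δ {u} {v} {w} xor≡true = lookup⇒[]= w _ (trans (lookup∘tabulate (λ w → adj G u w xor adj G v w) w) xor≡true)

  ∈Δ⇒adj≢ : ∀ {u v w} → w ∈ Δ G u v → adj G u w ≢ adj G v w
  ∈Δ⇒adj≢ {u} {v} {w} w∈Δ adj≡
    with () ← trans (sym (xor-same (adj G u w))) (trans (cong (adj G u w xor_) adj≡) (∈Δ⇒xor w∈Δ))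

  ∉Δ⇒adj≡ : ∀ {u v w} → w ∉ Δ G u v → adj G u w ≡ adj G v w
  ∉Δ⇒adj≡ w∉Δ = decidable-stable (_ Bool.≟ _) (λ adj≢ → w∉Δ (xor⇒∈Δ (≢⇒xor≡true adj≢)))

  non-edge⇒HasDup-Δ : ∀ {u v} → u ≢ v → adj G u v ≡ false → HasDup G (Δ G u v)
  non-edge⇒HasDup-Δ {u} {v} u≢v u≁v = u , v , u≢v , u∉Δ , v∉Δ , λ _ → ∉Δ⇒adj≡
    where
    u∉Δ : u ∉ Δ G u v
    u∉Δ u∈Δ = ∈Δ⇒adj≢ u∈Δ (trans (irrefl G u) (sym (trans (Graph.sym G v u) u≁v)))
    v∉Δ : v ∉ Δ G u v
    v∉Δ v∈Δ = ∈Δ⇒adj≢ v∈Δ (trans u≁v (sym (irrefl G v)))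

  IsMinΔ⇒IsTau : ∀ {d} → IsMinΔ G d → IsTau G d
  IsMinΔ⇒IsTau {d} ((u , v , u≢v , u≁v , ∣Δ∣≡d) , least) = (Δ G u v , non-edge⇒HasDup-Δ u≢v u≁v , ∣Δ∣≡d) , minimal
    where
    minimal : ∀ S → HasDup G S → d ≤ ∣ S ∣
    minimal S (u' , v' , u'≢v' , _ , v'∉S , agree) =
      ℕ.≤-trans (least u' v' u'≢v' (trans (agree v' v'∉S) (irrefl G v'))) (p⊆q⇒∣p∣≤∣q∣ Δ⊆S)
      where
      Δ⊆S : Δ G u' v' ⊆ S
      Δ⊆S {w} w∈Δ = decidable-stable (w ∈? S) (λ w∉S → ∈Δ⇒adj≢ w∈Δ (agree w w∉S))

  private
    pairs : List (Fin n × Fin n)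
    pairs = cartesianProduct (allFin n) (allFin n)

    ∈pairs : ∀ u v → (u , v) ∈ˡ pairs
    ∈pairs u v = ∈-cartesianProduct⁺ (∈-allFin u) (∈-allFin v)

    non-edge? : Decidable (λ ((u , v) : Fin n × Fin n) → u ≢ v × adj G u v ≡ false)
    non-edge? (u , v) = ¬? (u Fin.≟ v) ×-dec (adj G u v Bool.≟ false)

  minimalΔ : ¬ Complete G → ∃ (IsMinΔ G)
  minimalΔ ¬complete with minimiser non-edge? (λ (u , v) → ∣ Δ G u v ∣) pairs
  ... | inj₁ none = contradiction (λ u v u≢v → ¬-not (λ u≁v → none (∈pairs u v) (u≢v , u≁v))) ¬complete
  ... | inj₂ ((u , v) , (u≢v , u≁v) , least) =
    ∣ Δ G u v ∣ , (u , v , u≢v , u≁v , refl) , λ u' v' u'≢v' u'≁v' → least (∈pairs u' v') (u'≢v' , u'≁v')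

  ¬IndepRows-beyond-span : ∀ {T r k} (B : Family r n) →
    (∀ {w} → w ∈ T → restrict T (row G w) ∈Span B) → r < k → ¬ IndepRows G T k
  ¬IndepRows-beyond-span {T} {k = k} B spans r<k (g , _ , g∈T , ind) =
    Dependent⇒¬Independent (spanned-by-fewer⇒Dependent B (λ i → spans (g∈T i)) r<k) independent
    where
    independent : Independent (λ i → restrict T (row G (g i)))
    independent c rel = ind c λ j j∈T → begin
      Σℚ k (λ i → c i * entry (adj G (g i) j))      ≡⟨ Σℚ≡sum k _ ⟩
      lincomb c (λ i → row G (g i)) j               ≡⟨ sym (mask-yes (j ∈? T) j∈T) ⟩
      restrict T (lincomb c (λ i → row G (g i))) j  ≡⟨ sym (lincomb-restrict T c (λ i → row G (g i)) j) ⟩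
      lincomb c (λ i → restrict T (row G (g i))) j  ≡⟨ rel j ⟩
      0ℚ                                            ∎
      where open ≡-Reasoning

  Independent⇒IndepRows⊤ : ∀ {k} (f : Fin k → Fin n) → Independent (λ i → row G (f i)) → IndepRows G ⊤ k
  Independent⇒IndepRows⊤ {k} f ind =
    f , (λ fi≡fi' → Independent⇒Injective ind (λ j → cong (λ w → row G w j) fi≡fi')) , (λ _ → ∈⊤) ,
    λ c rel → ind c (λ j → trans (sym (Σℚ≡sum k _)) (rel j ∈⊤))

  agree-off⇒RankDrops : ∀ {S u v} → (∀ w → w ∉ S → adj G u w ≡ adj G v w) →
    ¬ (∀ w → adj G u w ≡ adj G v w) → RankDrops G S
  agree-off⇒RankDrops {S} {u} {v} agree differ =
    suc size , extended ,
    ¬IndepRows-beyond-span (λ i → restrict T (row G (index i))) (λ {w} _ → spans (∈-allFin w)) (ℕ.n<1+n size)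
    where
    T = ∁ S
    open Basis (basis (λ w → restrict T (row G w)) (allFin n))
    rows : Family size n
    rows i = row G (index i)
    extend-by : ∀ w → IndepRows G ⊤ (suc size) ⊎ row G w ∈Span rows
    extend-by w = [ (λ dep → inj₂ (Dependent-∷⇒∈Span (Independent-restrict⇒Independent independent) dep))
                  , (λ ind → inj₁ (Independent⇒IndepRows⊤ (w ◂ index) ind)) ]′ (Dependent⊎Independent (row G w ◂ rows))
    extended : IndepRows G ⊤ (suc size)
    extended with extend-by u | extend-by v
    ... | inj₁ indep | _          = indep
    ... | inj₂ _     | inj₁ indep = indep
    ... | inj₂ u∈    | inj₂ v∈    = contradiction (λ w → entry-injective (∈Span-determined-on independent u∈ v∈ u≗v w)) differ
      where
      u≗v : ∀ j → j ∈ T → row G u j ≡ row G v j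
      u≗v j j∈T = cong entry (agree j (x∈∁p⇒x∉p j∈T))

corollary2p2 : ∀ {n} (G : Graph n) → Reduced G → ¬ Complete G →
    ∃ λ d → IsMinΔ G d × IsTau G d × (∃ λ S → ∣ S ∣ ≤ d × RankDrops G S)
corollary2p2 G reduced ¬complete with minimalΔ G ¬complete
... | d , minΔ@((u , v , u≢v , _ , ∣Δ∣≡d) , _) =
  d , minΔ , IsMinΔ⇒IsTau G minΔ ,
  (Δ G u v , ℕ.≤-reflexive ∣Δ∣≡d , agree-off⇒RankDrops G (λ _ → ∉Δ⇒adj≡ G) (proj₂ reduced u v u≢v))
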